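{- Let $P$ be a set of ports and $X=P\cup\dot P\cup\overline P$. For all $a,c,b_1,\dots,b_n\subseteq X$ with $\dot{\mathrm{sup}}(a)=\emptyset$ and all causal interaction trees $t_1,\dots,t_n$ over $X$, the equality $$c\rightarrow a\rightarrow\bigoplus_{i=1}^n(b_i\rightarrow t_i)=c\rightarrow\bigoplus_{i=1}^n(ab_i\rightarrow t_i)$$ is derivable from the axioms (A1)–(A7).
   Context: $\dot P=\{\dot p:p\in P\}$ (firing typings), $P$ (activation typings), $\overline P=\{\overline p:p\in P\}$ (negative typings); for $a\subseteq X$, $\dot{\mathrm{sup}}(a)=\{p\in P:\dot p\in a\}$. Causal interaction trees over $X$ are generated by $t::=a\mid a\rightarrow t\mid t\oplus t$, where a node $a$ is an interaction $a\subseteq X$ (the empty interaction denoted $1$) or the constant $0$; $\rightarrow$ is right-associative and binds stronger than $\oplus$. For nodes, $a\cdot b=ab$ denotes $a\cup b$ ($ap=a\cup\{p\}$), with $0$ absorbing. Axioms: (A1) for $p\in P$ and nonempty $a\subseteq X$: $a\cdot0=0$; $a\cdot1=a$ for $a\ne0$; $\dot p\cdot p=\dot p$; $\dot p\cdot\overline p=p\cdot\overline p=0$. (A2) $\oplus$ is associative, commutative, idempotent with identity $0$. (A3) $a\rightarrow0=a$. (A4) $0\rightarrow t=0$. (A5) $c\rightarrow a\rightarrow b\rightarrow t=c\rightarrow ab\rightarrow t$ whenever $\dot{\mathrm{sup}}(a)=\emptyset$. (A6) $ap\rightarrow b=ap\rightarrow bp$ for $p\in X$. (A7) $a\rightarrow(t_1\oplus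 t_2)=(a\rightarrow t_1)\oplus(a\rightarrow t_2)$. Equalities are derived by equational reasoning (substitution in any context). -}

module Defs where

open import Data.Nat using (ℕ; zero; suc)
open import Data.Fin using (Fin; zero; suc)
open import Data.Product using (∃)
open import Relation.Nullary using (¬_)
open import Relation.Unary using (Pred; _∪_; _⊆_; ｛_｝; ∅)
open import Level using (0ℓ)

-- Typings over a set of ports P:  X = P ∪ Ṗ ∪ P̄
data Typing (P : Set) : Set where
  act  : P → Typing P
  fire : P → Typing P
  neg  : P → Typing P

Interaction : Set → Set₁
Interaction P = Pred (Typing P) 0ℓ

-- dot-sup(a) = ∅ : a contains no firing typing
NoFiring : {P : Set} → Interaction P → Set
NoFiring {P} a = (p : P) → ¬ a (fire p)

data Node (P : Set) : Set₁ where
  𝟘   : Node P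
  int : Interaction P → Node P

𝟙 : {P : Set} → Node P
𝟙 = int ∅

⟨_⟩ : {P : Set} → Typing P → Node P
⟨ x ⟩ = int ｛ x ｝

infixl 7 _·_
_·_ : {P : Set} → Node P → Node P → Node P
𝟘     · _     = 𝟘
int a · 𝟘     = 𝟘
int a · int b = int (a ∪ b)

infixr 6 _⇒_
infixr 5 _⊕_
data Tree (P : Set) : Set₁ where
  leaf : Node P → Tree P
  _⇒_  : Node P → Tree P → Tree P
  _⊕_  : Tree P → Tree P → Tree P

-- Derivable equality of nodes: equivalence, set-extensionality of
-- interactions, congruence for ·, and the axioms (A1)
-- (a·0 = 0 and a·1 = a hold by the definition of · up to extensionality).
infix 4 _≈ₙ_
data _≈ₙ_ {P : Set} : Node P → Node P → Set₁ where
  reflₙ   : ∀ {n} → n ≈ₙ n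
  symₙ    : ∀ {n m} → n ≈ₙ m → m ≈ₙ n
  transₙ  : ∀ {n m k} → n ≈ₙ m → m ≈ₙ k → n ≈ₙ k
  extₙ    : ∀ {a b : Interaction P} → a ⊆ b → b ⊆ a → int a ≈ₙ int b
  ·-congˡ : ∀ {n m k} → n ≈ₙ m → n · k ≈ₙ m · k
  ·-congʳ : ∀ {n m k} → n ≈ₙ m → k · n ≈ₙ k · m
  A1-fa   : ∀ (p : P) → ⟨ fire p ⟩ · ⟨ act p ⟩ ≈ₙ ⟨ fire p ⟩
  A1-fn   : ∀ (p : P) → ⟨ fire p ⟩ · ⟨ neg p ⟩ ≈ₙ 𝟘
  A1-an   : ∀ (p : P) → ⟨ act p ⟩ · ⟨ neg p ⟩ ≈ₙ 𝟘

infix 4 _≈_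
data _≈_ {P : Set} : Tree P → Tree P → Set₁ where
  refl≈  : ∀ {t} → t ≈ t
  sym≈   : ∀ {t u} → t ≈ u → u ≈ t
  trans≈ : ∀ {t u v} → t ≈ u → u ≈ v → t ≈ v
  leaf-cong : ∀ {n m} → n ≈ₙ m → leaf n ≈ leaf m
  ⇒-congˡ   : ∀ {n m t} → n ≈ₙ m → n ⇒ t ≈ m ⇒ t
  ⇒-congʳ   : ∀ {n t u} → t ≈ u → n ⇒ t ≈ n ⇒ u
  ⊕-cong    : ∀ {t t' u u'} → t ≈ t' → u ≈ u' → t ⊕ u ≈ t' ⊕ u'
  ⊕-assoc : ∀ t u v → (t ⊕ u) ⊕ v ≈ t ⊕ (u ⊕ v)
  ⊕-comm  : ∀ t u → t ⊕ u ≈ u ⊕ t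
  ⊕-idem  : ∀ t → t ⊕ t ≈ t
  ⊕-idˡ   : ∀ t → leaf 𝟘 ⊕ t ≈ t
  A3 : ∀ (a : Node P) → a ⇒ leaf 𝟘 ≈ leaf a
  A4 : ∀ t → 𝟘 ⇒ t ≈ leaf 𝟘
  A5 : ∀ (c : Node P) (a : Interaction P) (b : Node P) t → NoFiring a →
       c ⇒ int a ⇒ b ⇒ t ≈ c ⇒ int a · b ⇒ t
  -- (A6) ap → b = ap → bp   for p ∈ X  (b a node, i.e. a leaf)
  A6 : ∀ (a : Node P) (p : Typing P) (b : Node P) →
       a · ⟨ p ⟩ ⇒ leaf b ≈ a · ⟨ p ⟩ ⇒ leaf (b · ⟨ p ⟩)
  A7 : ∀ (a : Node P) t₁ t₂ → a ⇒ (t₁ ⊕ t₂) ≈ (a ⇒ t₁) ⊕ (a ⇒ t₂)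

⨁ : {P : Set} (n : ℕ) → (Fin (suc n) → Tree P) → Tree P
⨁ zero    f = f zero
⨁ (suc n) f = f zero ⊕ ⨁ n (λ i → f (suc i))

module Submission where

open import Defs
open import Data.Nat using (ℕ; suc; zero)
open import Data.Fin using (Fin; zero; suc)
open import Level using (0ℓ) renaming (suc to lsuc)
open import Relation.Binary.Bundles using (Setoid)
open import Relation.Binary.Structures using (IsEquivalence)
import Relation.Binary.Reasoning.Setoid as SetoidReasoning

≈-isEquivalence : {P : Set} → IsEquivalence (_≈_ {P})
≈-isEquivalence = record { refl = refl≈ ; sym = sym≈ ; trans = trans≈ }

≈-setoid : Set → Setoid (lsuc 0ℓ) (lsuc 0ℓ)
≈-setoid P = record { Carrier = Tree P ; _≈_ = _≈_ ; isEquivalence = ≈-isEquivalence }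

⨁-cong : {P : Set} (n : ℕ) {f g : Fin (suc n) → Tree P} →
         (∀ i → f i ≈ g i) → ⨁ n f ≈ ⨁ n g
⨁-cong zero    f≈g = f≈g zero
⨁-cong (suc n) f≈g = ⊕-cong (f≈g zero) (⨁-cong n (λ i → f≈g (suc i)))

⇒-distribˡ-⨁ : {P : Set} (n : ℕ) (a : Node P) (f : Fin (suc n) → Tree P) →
               a ⇒ ⨁ n f ≈ ⨁ n (λ i → a ⇒ f i)
⇒-distribˡ-⨁ zero    a f = refl≈
⇒-distribˡ-⨁ (suc n) a f =
  trans≈ (A7 a _ _) (⊕-cong refl≈ (⇒-distribˡ-⨁ n a (λ i → f (suc i))))

lemma5 : {P : Set} (n : ℕ) (a c : Interaction P)
         (b : Fin (suc n) → Interaction P) (t : Fin (suc n) → Tree P) →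
         NoFiring a →
         int c ⇒ int a ⇒ ⨁ n (λ i → int (b i) ⇒ t i)
           ≈ int c ⇒ ⨁ n (λ i → int a · int (b i) ⇒ t i)
lemma5 {P} n a c b t noFiring = begin
  int c ⇒ int a ⇒ ⨁ n (λ i → int (b i) ⇒ t i)
    ≈⟨ ⇒-congʳ (⇒-distribˡ-⨁ n (int a) _) ⟩
  int c ⇒ ⨁ n (λ i → int a ⇒ int (b i) ⇒ t i)
    ≈⟨ ⇒-distribˡ-⨁ n (int c) _ ⟩
  ⨁ n (λ i → int c ⇒ int a ⇒ int (b i) ⇒ t i)
    ≈⟨ ⨁-cong n (λ i → A5 (int c) a (int (b i)) (t i) noFiring) ⟩
  ⨁ n (λ i → int c ⇒ int a · int (b i) ⇒ t i)
    ≈⟨ ⇒-distribˡ-⨁ n (int c) _ ⟨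
  int c ⇒ ⨁ n (λ i → int a · int (b i) ⇒ t i)
    ∎
  where open SetoidReasoning (≈-setoid P)
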